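{- Let $A$ be a real $k\times k$ generalized permutation matrix, and for $i=1,\dots,k$ let $u_i$ be the column of the unique nonzero entry of row $i$. For $i=1,\dots,k$ let $\Delta_{\{u_1,\dots,u_i\}}(A)$ be the determinant of the $i\times i$ submatrix of $A$ formed by rows $1,\dots,i$ and columns $u_1,\dots,u_i$ (columns taken in increasing order). Then $\Delta_{\{u_1,\dots,u_i\}}(A)\ge0$ for all $i=1,\dots,k$ if and only if $\mathrm{sgn}_A(i)=(-1)^{\mathrm{nep}_A(i)}$ for all $i=1,\dots,k$.
   Context: A generalized permutation matrix is a square matrix with exactly one nonzero entry in each row and each column. $\mathrm{sgn}_A(i)$ denotes the sign of the entry $A_{i,u_i}$, and $\mathrm{nep}_A(i)=|\{1\le j<i: u_j>u_i\}|$. -}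

module Defs where

open import Level using (Level; _⊔_) renaming (suc to lsuc)
open import Data.Nat using (ℕ; zero; suc) renaming (_<_ to _<ℕ_)
open import Data.Nat.Properties using () renaming (_<?_ to _<ℕ?_)
open import Data.Fin using (Fin; toℕ; _<_; _<?_; _≟_)
open import Data.List using (List; []; _∷_; length; lookup; removeAt; take; allFin; filter; map)
open import Data.List.Relation.Unary.Any using (Any; any?)
open import Data.Product using (Σ; ∃; _×_; _,_; proj₁)
open import Relation.Nullary using (¬_)
open import Relation.Binary using (Rel; IsTotalOrder)
open import Relation.Binary.PropositionalEquality using (_≡_; _≢_)
open import Algebra.Bundles using (CommutativeRing)

-- Ordered fields (the real numbers are one; stdlib has no ℝ).
-- A commutative ring with a total order compatible with + and *,
-- 0 ≠ 1, and multiplicative inverses of nonzero elements.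

record OrderedField (c ℓ₁ ℓ₂ : Level) : Set (lsuc (c ⊔ ℓ₁ ⊔ ℓ₂)) where
  field
    commutativeRing : CommutativeRing c ℓ₁
  open CommutativeRing commutativeRing public
  field
    _≤_          : Rel Carrier ℓ₂
    isTotalOrder : IsTotalOrder _≈_ _≤_
    +-mono-≤     : ∀ {x y} z → x ≤ y → (x + z) ≤ (y + z)
    *-nonneg     : ∀ {x y} → 0# ≤ x → 0# ≤ y → 0# ≤ (x * y)
    0≉1          : ¬ (0# ≈ 1#)
    inverse      : ∀ x → ¬ (x ≈ 0#) → ∃ λ y → (x * y) ≈ 1#

  _<ᶠ_ : Carrier → Carrier → Set (ℓ₁ ⊔ ℓ₂)
  x <ᶠ y = (x ≤ y) × ¬ (x ≈ y)

data Sign : Set where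
  plus minus : Sign

signPow : ℕ → Sign
signPow zero          = plus
signPow (suc zero)    = minus
signPow (suc (suc n)) = signPow n

module _ {c ℓ₁ ℓ₂ : Level} (F : OrderedField c ℓ₁ ℓ₂) where
  open OrderedField F

  HasSign : Carrier → Sign → Set (ℓ₁ ⊔ ℓ₂)
  HasSign x plus  = 0# <ᶠ x
  HasSign x minus = x <ᶠ 0#

  negPow : ℕ → Carrier → Carrier
  negPow zero    x = x
  negPow (suc n) x = - negPow n x

  sumFin : ∀ n → (Fin n → Carrier) → Carrier
  sumFin zero    f = 0#
  sumFin (suc n) f = f Fin.zero + sumFin n (λ p → f (Fin.suc p))

  Matrix : ℕ → Set c
  Matrix k = Fin k → Fin k → Carrier

  -- Determinant of the submatrix of A with rows rs and columns cs
  -- (in the listed order), by Laplace expansion along the first row.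
  -- (Only meaningful when length rs ≡ length cs, which is the case below.)
  subDet : ∀ {k} → Matrix k → List (Fin k) → List (Fin k) → Carrier
  subDet A []       []      = 1#
  subDet A []       (_ ∷ _) = 0#
  subDet A (r ∷ rs) cs      =
    sumFin (length cs) (λ p →
      negPow (toℕ p) (A r (lookup cs p) * subDet A rs (removeAt cs p)))

  IsGenPerm : ∀ {k} → Matrix k → Set ℓ₁
  IsGenPerm {k} A =
    (∀ i → Σ (Fin k) λ j → ¬ (A i j ≈ 0#) × (∀ j′ → ¬ (A i j′ ≈ 0#) → j′ ≡ j)) ×
    (∀ j → Σ (Fin k) λ i → ¬ (A i j ≈ 0#) × (∀ i′ → ¬ (A i′ j ≈ 0#) → i′ ≡ i))

  -- rows 1..i+1 (0-based: rows 0..i)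
  rowsUpTo : ∀ {k} → Fin k → List (Fin k)
  rowsUpTo {k} i = take (suc (toℕ i)) (allFin k)

  colsUpTo : ∀ {k} → (Fin k → Fin k) → Fin k → List (Fin k)
  colsUpTo {k} u i = filter (λ c → any? (λ r → u r ≟ c) (rowsUpTo i)) (allFin k)

  Δ : ∀ {k} → Matrix k → (Fin k → Fin k) → Fin k → Carrier
  Δ A u i = subDet A (rowsUpTo i) (colsUpTo u i)

nep : ∀ {k} → (Fin k → Fin k) → Fin k → ℕ
nep {k} u i = length (filter (λ j → u i <? u j) (filter (λ j → j <? i) (allFin k)))

{-# OPTIONS --safe #-}

-- Row r of A vanishes off column u r, so the Laplace expansion of a minor along row r has a
-- single term, whose sign is (-1)^(number of the minor's columns left of u r), the columns
-- being in increasing order.  Expanding along the first row and moving the new row to the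
-- front one row at a time yields the expansion along the last row,
--   Δ(i) = (-1)^nep(i) · A(i, u i) · Δ(i - 1),
-- with the minor on no rows equal to 1.  All these minors are nonzero, so every Δ(i) is ≥ 0
-- iff every factor (-1)^nep(i) · A(i, u i) is positive, which is the sign condition.

module Submission where

open import Defs
open import Level using (Level)
open import Data.Fin using (Fin)
open import Data.Product using (_×_)
open import Relation.Nullary using (¬_)
open import Function.Bundles using (_⇔_)

import Algebra.Properties.CommutativeSemigroup as CommutativeSemigroupProperties
import Algebra.Properties.Ring as RingProperties
open import Data.Fin using (toℕ; fromℕ<; _<_; _<?_; _≟_) renaming (zero to fzero; suc to fsuc)
import Data.Fin.Properties as Fin
open import Data.List
  using (List; []; _∷_; [_]; _++_; _∷ʳ_; length; filter; tabulate; take; allFin; lookup; removeAt)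
open import Data.List.Membership.Propositional using (_∈_; _∉_)
open import Data.List.Membership.Propositional.Properties using (∈-filter⁺; ∈-filter⁻; ∈-allFin)
open import Data.List.Properties
  using (filter-accept; filter-reject; filter-none; filter-all; filter-++; length-++; take-suc-tabulate)
open import Data.List.Relation.Binary.Permutation.Propositional using (_↭_)
open import Data.List.Relation.Binary.Permutation.Propositional.Properties using (↭-length; filter-↭; shift)
open import Data.List.Relation.Unary.All as All using (All; []; _∷_)
import Data.List.Relation.Unary.All.Properties as All
open import Data.List.Relation.Unary.AllPairs using (AllPairs; []; _∷_)
import Data.List.Relation.Unary.AllPairs.Properties as AllPairs
open import Data.List.Relation.Unary.Any using (Any; any?; here; there)
open import Data.List.Relation.Unary.Unique.Propositional using (Unique)
import Data.List.Relation.Unary.Unique.Propositional.Properties as Unique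
open import Data.Nat using (ℕ; zero; suc) renaming (_+_ to _+ℕ_)
import Data.Nat as ℕ
import Data.Nat.Properties as ℕ
open import Data.Product using (_,_; proj₁; proj₂)
open import Data.Sum using (_⊎_; inj₁; inj₂)
open import Effect.Monad using (RawMonad)
open import Function using (_∘_; id; Equivalence; mk⇔)
open import Function.Definitions using (Injective)
open import Level using (0ℓ)
open import Relation.Binary using (IsTotalOrder; tri<; tri≈; tri>)
open import Relation.Binary.PropositionalEquality as ≡ using (_≡_; _≢_)
import Relation.Binary.Reasoning.Setoid as SetoidReasoning
open import Relation.Nullary using (yes; no; contradiction)
open import Relation.Nullary.Negation using (Stable; ¬¬-Monad; ¬¬-map)
open import Relation.Unary using (Pred; Decidable)

¬¬-∀Fin : ∀ {p n} {P : Fin n → Set p} → (∀ i → ¬ ¬ P i) → ¬ ¬ (∀ i → P i)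
¬¬-∀Fin = Fin.sequence (RawMonad.rawApplicative ¬¬-Monad)

count : ∀ {a p} {A : Set a} {P : Pred A p} → Decidable P → List A → ℕ
count P? xs = length (filter P? xs)

module _ {a p : Level} {A : Set a} {P : Pred A p} (P? : Decidable P) where

  count-++ : ∀ xs ys → count P? (xs ++ ys) ≡ count P? xs +ℕ count P? ys
  count-++ xs ys = ≡.trans (≡.cong length (filter-++ P? xs ys)) (length-++ (filter P? xs))

  count-↭ : ∀ {xs ys} → xs ↭ ys → count P? xs ≡ count P? ys
  count-↭ xs↭ys = ↭-length (filter-↭ P? xs↭ys)

  filter-tabulate-< : ∀ {n} (f : Fin n → A) (i : Fin n) → (∀ j → P (f j) ⇔ j < i) →
                      filter P? (tabulate f) ≡ take (toℕ i) (tabulate f)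
  filter-tabulate-< f fzero    P⇔<i =
    filter-none P? (All.tabulate⁺ λ j Pfj → contradiction (Equivalence.to (P⇔<i j) Pfj) λ ())
  filter-tabulate-< f (fsuc i) P⇔<i = ≡.trans
    (filter-accept P? (Equivalence.from (P⇔<i fzero) ℕ.z<s))
    (≡.cong (f fzero ∷_) (filter-tabulate-< (f ∘ fsuc) i λ j →
      mk⇔ (ℕ.s<s⁻¹ ∘ Equivalence.to (P⇔<i (fsuc j))) (Equivalence.from (P⇔<i (fsuc j)) ∘ ℕ.s<s)))

  module _ {q : Level} {Q : Pred A q} (Q? : Decidable Q) where

    filter-comm : ∀ xs → filter P? (filter Q? xs) ≡ filter Q? (filter P? xs)
    filter-comm []       = ≡.refl
    filter-comm (x ∷ xs) with P? x | Q? x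
    ... | yes Px | yes Qx = ≡.trans (filter-accept P? Px)
                              (≡.trans (≡.cong (x ∷_) (filter-comm xs)) (≡.sym (filter-accept Q? Qx)))
    ... | yes _  | no ¬Qx = ≡.trans (filter-comm xs) (≡.sym (filter-reject Q? ¬Qx))
    ... | no ¬Px | yes _  = ≡.trans (filter-reject P? ¬Px) (filter-comm xs)
    ... | no _   | no _   = filter-comm xs

    filter-≐-All : ∀ {xs} → All (λ x → P x ⇔ Q x) xs → filter P? xs ≡ filter Q? xs
    filter-≐-All {[]}     []              = ≡.refl
    filter-≐-All {x ∷ xs} (Px⇔Qx ∷ P⇔Q) with P? x
    ... | yes Px = ≡.trans (≡.cong (x ∷_) (filter-≐-All P⇔Q))
                           (≡.sym (filter-accept Q? (Equivalence.to Px⇔Qx Px)))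
    ... | no ¬Px = ≡.trans (filter-≐-All P⇔Q)
                           (≡.sym (filter-reject Q? (¬Px ∘ Equivalence.from Px⇔Qx)))

    count-singleton : ∀ {x y} → P x ⇔ Q y → count P? [ x ] ≡ count Q? [ y ]
    count-singleton {x} {y} Px⇔Qy with P? x | Q? y
    ... | yes _  | yes _  = ≡.refl
    ... | no  _  | no  _  = ≡.refl
    ... | yes Px | no ¬Qy = contradiction (Equivalence.to Px⇔Qy Px) ¬Qy
    ... | no ¬Px | yes Qy = contradiction (Equivalence.from Px⇔Qy Qy) ¬Px

Unique-++⁻ˡ : ∀ {a} {A : Set a} (xs : List A) {ys} → Unique (xs ++ ys) → Unique xs
Unique-++⁻ˡ []       _              = []
Unique-++⁻ˡ (x ∷ xs) (x∉ ∷ unique) = All.++⁻ˡ xs x∉ ∷ Unique-++⁻ˡ xs unique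

module _ {k : ℕ} (x : Fin k) where

  below above : List (Fin k) → List (Fin k)
  below = filter (_<? x)
  above = filter (x <?_)

  sorted-split-∉ : ∀ {L} → AllPairs _<_ L → x ∉ L → L ≡ below L ++ above L
  sorted-split-∉ {[]}    []              x∉L = ≡.refl
  sorted-split-∉ {y ∷ L} (y<L ∷ sorted) x∉L with Fin.<-cmp y x
  ... | tri< y<x _ _ = ≡.trans (≡.cong (y ∷_) (sorted-split-∉ sorted (x∉L ∘ there)))
    (≡.cong₂ _++_
      (≡.sym (filter-accept (_<? x) y<x)) (≡.sym (filter-reject (x <?_) (Fin.<-asym y<x))))
  ... | tri≈ _ y≡x _ = contradiction (here (≡.sym y≡x)) x∉L
  ... | tri> _ _ x<y = ≡.sym (≡.cong₂ _++_
    (filter-none (_<? x) (Fin.<-asym x<y ∷ All.map (λ y<c → Fin.<-asym (Fin.<-trans x<y y<c)) y<L))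
    (filter-all (x <?_) (x<y ∷ All.map (Fin.<-trans x<y) y<L)))

  sorted-split-∈ : ∀ {L} → AllPairs _<_ L → x ∈ L → L ≡ below L ++ x ∷ above L
  sorted-split-∈ {y ∷ L} (y<L ∷ sorted) (here ≡.refl) = ≡.sym (≡.cong₂ (λ l l′ → l ++ x ∷ l′)
    (filter-none (_<? x) (Fin.<-irrefl ≡.refl ∷ All.map Fin.<-asym y<L))
    (≡.trans (filter-reject (x <?_) (Fin.<-irrefl ≡.refl)) (filter-all (x <?_) y<L)))
  sorted-split-∈ {y ∷ L} (y<L ∷ sorted) (there x∈L) = ≡.trans (≡.cong (y ∷_) (sorted-split-∈ sorted x∈L))
    (≡.cong₂ (λ l l′ → l ++ x ∷ l′)
      (≡.sym (filter-accept (_<? x) y<x)) (≡.sym (filter-reject (x <?_) (Fin.<-asym y<x))))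
    where
    y<x : y < x
    y<x = All.lookup y<L x∈L

module OrderedFieldProperties {c ℓ₁ ℓ₂ : Level} (F : OrderedField c ℓ₁ ℓ₂) where

  open OrderedField F
  open IsTotalOrder isTotalOrder using (total; antisym; ≲-respˡ-≈; ≲-respʳ-≈)
  open RingProperties ring using (-0#≈0#; -‿involutive; -‿distribˡ-*; -‿distribʳ-*)
  open SetoidReasoning setoid

  -‿antimono-≤ : ∀ {x y} → x ≤ y → (- y) ≤ (- x)
  -‿antimono-≤ {x} {y} x≤y = ≲-respˡ-≈ x-y-x≈-y (≲-respʳ-≈ y-y-x≈-x (+-mono-≤ (- y + - x) x≤y))
    where
    x-y-x≈-y : x + (- y + - x) ≈ - y
    x-y-x≈-y = begin
      x + (- y + - x) ≈⟨ +-congˡ (+-comm (- y) (- x)) ⟩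
      x + (- x + - y) ≈⟨ +-assoc x (- x) (- y) ⟨
      x + - x + - y   ≈⟨ +-congʳ (-‿inverseʳ x) ⟩
      0# + - y        ≈⟨ +-identityˡ (- y) ⟩
      - y             ∎
    y-y-x≈-x : y + (- y + - x) ≈ - x
    y-y-x≈-x = begin
      y + (- y + - x) ≈⟨ +-assoc y (- y) (- x) ⟨
      y + - y + - x   ≈⟨ +-congʳ (-‿inverseʳ y) ⟩
      0# + - x        ≈⟨ +-identityˡ (- x) ⟩
      - x             ∎

  x≤0⇒0≤-x : ∀ {x} → x ≤ 0# → 0# ≤ (- x)
  x≤0⇒0≤-x x≤0 = ≲-respˡ-≈ -0#≈0# (-‿antimono-≤ x≤0)

  0≤-x⇒x≤0 : ∀ {x} → 0# ≤ (- x) → x ≤ 0#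
  0≤-x⇒x≤0 {x} 0≤-x = ≲-respˡ-≈ (-‿involutive x) (≲-respʳ-≈ -0#≈0# (-‿antimono-≤ 0≤-x))

  -x≈0⇒x≈0 : ∀ {x} → - x ≈ 0# → x ≈ 0#
  -x≈0⇒x≈0 {x} -x≈0 = trans (sym (-‿involutive x)) (trans (-‿cong -x≈0) -0#≈0#)

  x<0⇒0<-x : ∀ {x} → x <ᶠ 0# → 0# <ᶠ (- x)
  x<0⇒0<-x (x≤0 , x≉0) = x≤0⇒0≤-x x≤0 , λ 0≈-x → x≉0 (-x≈0⇒x≈0 (sym 0≈-x))

  0<-x⇒x<0 : ∀ {x} → 0# <ᶠ (- x) → x <ᶠ 0#
  0<-x⇒x<0 (0≤-x , 0≉-x) = 0≤-x⇒x≤0 0≤-x , λ x≈0 → 0≉-x (sym (trans (-‿cong x≈0) -0#≈0#))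

  0<-respʳ-≈ : ∀ {x y} → x ≈ y → 0# <ᶠ x → 0# <ᶠ y
  0<-respʳ-≈ x≈y (0≤x , 0≉x) = ≲-respʳ-≈ x≈y 0≤x , λ 0≈y → 0≉x (trans 0≈y (sym x≈y))

  x≉0⇒0<x⊎x<0 : ∀ {x} → ¬ (x ≈ 0#) → 0# <ᶠ x ⊎ x <ᶠ 0#
  x≉0⇒0<x⊎x<0 {x} x≉0 with total 0# x
  ... | inj₁ 0≤x = inj₁ (0≤x , x≉0 ∘ sym)
  ... | inj₂ x≤0 = inj₂ (x≤0 , x≉0)

  x≉0∧y≉0⇒xy≉0 : ∀ {x y} → ¬ (x ≈ 0#) → ¬ (y ≈ 0#) → ¬ (x * y ≈ 0#)
  x≉0∧y≉0⇒xy≉0 {x} {y} x≉0 y≉0 xy≈0 with inverse x x≉0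
  ... | x⁻¹ , xx⁻¹≈1 = y≉0 (begin
    y             ≈⟨ *-identityˡ y ⟨
    1# * y        ≈⟨ *-congʳ xx⁻¹≈1 ⟨
    x * x⁻¹ * y   ≈⟨ *-congʳ (*-comm x x⁻¹) ⟩
    x⁻¹ * x * y   ≈⟨ *-assoc x⁻¹ x y ⟩
    x⁻¹ * (x * y) ≈⟨ *-congˡ xy≈0 ⟩
    x⁻¹ * 0#      ≈⟨ zeroʳ x⁻¹ ⟩
    0#            ∎)

  0<x∧0<y⇒0<xy : ∀ {x y} → 0# <ᶠ x → 0# <ᶠ y → 0# <ᶠ (x * y)
  0<x∧0<y⇒0<xy (0≤x , 0≉x) (0≤y , 0≉y) =
    *-nonneg 0≤x 0≤y , λ 0≈xy → x≉0∧y≉0⇒xy≉0 (0≉x ∘ sym) (0≉y ∘ sym) (sym 0≈xy)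

  0≤xy∧0<y⇒0<x : ∀ {x y} → ¬ (x ≈ 0#) → 0# <ᶠ y → 0# ≤ (x * y) → 0# <ᶠ x
  0≤xy∧0<y⇒0<x {x} {y} x≉0 0<y 0≤xy with x≉0⇒0<x⊎x<0 x≉0
  ... | inj₁ 0<x = 0<x
  ... | inj₂ x<0 = contradiction (sym (antisym 0≤xy xy≤0)) (x≉0∧y≉0⇒xy≉0 x≉0 (proj₂ 0<y ∘ sym))
    where
    xy≤0 : (x * y) ≤ 0#
    xy≤0 = 0≤-x⇒x≤0 (≲-respʳ-≈ (sym (-‿distribˡ-* x y))
                               (proj₁ (0<x∧0<y⇒0<xy (x<0⇒0<-x x<0) 0<y)))

  0<1 : 0# <ᶠ 1#
  0<1 with total 0# 1#
  ... | inj₁ 0≤1 = 0≤1 , 0≉1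
  ... | inj₂ 1≤0 = ≲-respʳ-≈ -1*-1≈1 (*-nonneg (x≤0⇒0≤-x 1≤0) (x≤0⇒0≤-x 1≤0)) , 0≉1
    where
    -1*-1≈1 : - 1# * - 1# ≈ 1#
    -1*-1≈1 = begin
      - 1# * - 1#   ≈⟨ -‿distribˡ-* 1# (- 1#) ⟨
      - (1# * - 1#) ≈⟨ -‿cong (*-identityˡ (- 1#)) ⟩
      - - 1#        ≈⟨ -‿involutive 1# ⟩
      1#            ∎

  0≤x-stable : ∀ {x} → ¬ (x ≈ 0#) → Stable (0# ≤ x)
  0≤x-stable x≉0 ¬¬0≤x with x≉0⇒0<x⊎x<0 x≉0
  ... | inj₁ (0≤x , _)   = 0≤x
  ... | inj₂ (x≤0 , x≉0) = contradiction (λ 0≤x → x≉0 (antisym x≤0 0≤x)) ¬¬0≤x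

  HasSign-stable : ∀ {x} s → ¬ (x ≈ 0#) → Stable (HasSign F x s)
  HasSign-stable s x≉0 ¬¬sign with s | x≉0⇒0<x⊎x<0 x≉0
  ... | plus  | inj₁ 0<x          = 0<x
  ... | minus | inj₂ x<0          = x<0
  ... | plus  | inj₂ (x≤0 , x≉0) = contradiction (λ (0≤x , _) → x≉0 (antisym x≤0 0≤x)) ¬¬sign
  ... | minus | inj₁ (0≤x , 0≉x) = contradiction (λ (x≤0 , _) → 0≉x (antisym 0≤x x≤0)) ¬¬sign

  negPow-cong : ∀ n {x y} → x ≈ y → negPow F n x ≈ negPow F n y
  negPow-cong zero    x≈y = x≈y
  negPow-cong (suc n) x≈y = -‿cong (negPow-cong n x≈y)

  negPow-+ : ∀ m n x → negPow F (m +ℕ n) x ≡ negPow F m (negPow F n x)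
  negPow-+ zero    n x = ≡.refl
  negPow-+ (suc m) n x = ≡.cong -_ (negPow-+ m n x)

  negPow-distribˡ-* : ∀ n x y → negPow F n (x * y) ≈ negPow F n x * y
  negPow-distribˡ-* zero    x y = refl
  negPow-distribˡ-* (suc n) x y = trans (-‿cong (negPow-distribˡ-* n x y)) (-‿distribˡ-* (negPow F n x) y)

  negPow-distribʳ-* : ∀ n x y → negPow F n (x * y) ≈ x * negPow F n y
  negPow-distribʳ-* zero    x y = refl
  negPow-distribʳ-* (suc n) x y = trans (-‿cong (negPow-distribʳ-* n x y)) (-‿distribʳ-* x (negPow F n y))

  negPow-*-negPow : ∀ m n x y → negPow F m (x * negPow F n y) ≈ negPow F (m +ℕ n) (x * y)
  negPow-*-negPow m n x y = begin
    negPow F m (x * negPow F n y)   ≈⟨ negPow-cong m (negPow-distribʳ-* n x y) ⟨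
    negPow F m (negPow F n (x * y)) ≡⟨ negPow-+ m n (x * y) ⟨
    negPow F (m +ℕ n) (x * y)       ∎

  negPow-≉0 : ∀ n {x} → ¬ (x ≈ 0#) → ¬ (negPow F n x ≈ 0#)
  negPow-≉0 zero    x≉0 = x≉0
  negPow-≉0 (suc n) x≉0 = negPow-≉0 n x≉0 ∘ -x≈0⇒x≈0

  HasSign⇔0<negPow : ∀ n x → HasSign F x (signPow n) ⇔ (0# <ᶠ negPow F n x)
  HasSign⇔0<negPow zero          x = mk⇔ id id
  HasSign⇔0<negPow (suc zero)    x = mk⇔ x<0⇒0<-x 0<-x⇒x<0
  HasSign⇔0<negPow (suc (suc n)) x = mk⇔
    (0<-respʳ-≈ (sym (-‿involutive _)) ∘ Equivalence.to (HasSign⇔0<negPow n x))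
    (Equivalence.from (HasSign⇔0<negPow n x) ∘ 0<-respʳ-≈ (-‿involutive _))

module Laplace {c ℓ₁ ℓ₂ : Level} (F : OrderedField c ℓ₁ ℓ₂) {k : ℕ} (A : Matrix F k) where

  open OrderedField F
  open RingProperties ring using (-0#≈0#; -‿+-comm)
  open SetoidReasoning setoid

  sumFin-neg : ∀ n (f : Fin n → Carrier) → sumFin F n (λ p → - f p) ≈ - sumFin F n f
  sumFin-neg zero    f = sym -0#≈0#
  sumFin-neg (suc n) f = trans (+-congˡ (sumFin-neg n (f ∘ fsuc))) (-‿+-comm (f fzero) (sumFin F n (f ∘ fsuc)))

  -- subDet A (r ∷ rs) cs is laplace r cs (subDet A rs); abstracting the minor lets the
  -- expansion be peeled off one column at a time.
  laplace : Fin k → List (Fin k) → (List (Fin k) → Carrier) → Carrier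
  laplace r cs minor = sumFin F (length cs) (λ p → negPow F (toℕ p) (A r (lookup cs p) * minor (removeAt cs p)))

  laplace-∷ : ∀ r c cs minor → laplace r (c ∷ cs) minor ≈ A r c * minor cs - laplace r cs (minor ∘ (c ∷_))
  laplace-∷ r c cs minor = +-congˡ (sumFin-neg (length cs) _)

  laplace-vanishing : ∀ {r cs} minor → All (λ c → A r c ≈ 0#) cs → laplace r cs minor ≈ 0#
  laplace-vanishing minor [] = refl
  laplace-vanishing {r} {c ∷ cs} minor (Arc≈0 ∷ Ar≈0) = begin
    laplace r (c ∷ cs) minor
      ≈⟨ laplace-∷ r c cs minor ⟩
    A r c * minor cs - laplace r cs (minor ∘ (c ∷_))
      ≈⟨ +-cong (trans (*-congʳ Arc≈0) (zeroˡ _)) (-‿cong (laplace-vanishing (minor ∘ (c ∷_)) Ar≈0)) ⟩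
    0# - 0#
      ≈⟨ -‿inverseʳ 0# ⟩
    0#
      ∎

  laplace-single-entry : ∀ {r} xs {c ys} minor →
                         All (λ c′ → A r c′ ≈ 0#) xs → All (λ c′ → A r c′ ≈ 0#) ys →
                         laplace r (xs ++ c ∷ ys) minor ≈ negPow F (length xs) (A r c * minor (xs ++ ys))
  laplace-single-entry {r} [] {c} {ys} minor [] Arys≈0 = begin
    laplace r (c ∷ ys) minor
      ≈⟨ laplace-∷ r c ys minor ⟩
    A r c * minor ys - laplace r ys (minor ∘ (c ∷_))
      ≈⟨ +-congˡ (trans (-‿cong (laplace-vanishing (minor ∘ (c ∷_)) Arys≈0)) -0#≈0#) ⟩
    A r c * minor ys + 0#
      ≈⟨ +-identityʳ _ ⟩
    A r c * minor ys
      ∎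
  laplace-single-entry {r} (x ∷ xs) {c} {ys} minor (Arx≈0 ∷ Arxs≈0) Arys≈0 = begin
    laplace r (x ∷ xs ++ c ∷ ys) minor
      ≈⟨ laplace-∷ r x (xs ++ c ∷ ys) minor ⟩
    A r x * minor (xs ++ c ∷ ys) - laplace r (xs ++ c ∷ ys) (minor ∘ (x ∷_))
      ≈⟨ +-cong (trans (*-congʳ Arx≈0) (zeroˡ _))
                (-‿cong (laplace-single-entry xs (minor ∘ (x ∷_)) Arxs≈0 Arys≈0)) ⟩
    0# - negPow F (length xs) (A r c * minor (x ∷ xs ++ ys))
      ≈⟨ +-identityˡ _ ⟩
    negPow F (length (x ∷ xs)) (A r c * minor (x ∷ xs ++ ys))
      ∎

module Columns {k : ℕ} (u : Fin k → Fin k) (u-injective : Injective _≡_ _≡_ u) where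

  ColumnOf : List (Fin k) → Pred (Fin k) 0ℓ
  ColumnOf rs c = Any (λ r → u r ≡ c) rs

  columnOf? : ∀ rs → Decidable (ColumnOf rs)
  columnOf? rs c = any? (λ r → u r ≟ c) rs

  cols : List (Fin k) → List (Fin k)
  cols rs = filter (columnOf? rs) (allFin k)

  cols-[] : cols [] ≡ []
  cols-[] = filter-none (columnOf? []) (All.tabulate⁺ {f = id} λ _ ())

  cols-sorted : ∀ rs → AllPairs _<_ (cols rs)
  cols-sorted rs = AllPairs.filter⁺ (columnOf? rs) (AllPairs.tabulate⁺-< id)

  module _ {r : Fin k} {rs : List (Fin k)} (r∉rs : All (r ≢_) rs) where

    u∉cols : u r ∉ cols rs
    u∉cols ur∈cols =
      All.All¬⇒¬Any (All.map (λ r≢r′ ur′≡ur → r≢r′ (≡.sym (u-injective ur′≡ur))) r∉rs)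
                    (proj₂ (∈-filter⁻ (columnOf? rs) {xs = allFin k} ur∈cols))

    cols-∷-away : ∀ {p} {R : Pred (Fin k) p} (R? : Decidable R) → (∀ {c} → R c → c ≢ u r) →
                  filter R? (cols (r ∷ rs)) ≡ filter R? (cols rs)
    cols-∷-away R? R⇒≢ = ≡.trans (filter-comm R? (columnOf? (r ∷ rs)) (allFin k)) (≡.trans
      (filter-≐-All (columnOf? (r ∷ rs)) (columnOf? rs)
        (All.map (λ Rc → mk⇔ (column-of-rs (R⇒≢ Rc)) there) (All.all-filter R? (allFin k))))
      (≡.sym (filter-comm R? (columnOf? rs) (allFin k))))
      where
      column-of-rs : ∀ {c} → c ≢ u r → ColumnOf (r ∷ rs) c → ColumnOf rs c
      column-of-rs c≢ur (here ur≡c)  = contradiction (≡.sym ur≡c) c≢ur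
      column-of-rs c≢ur (there c∈rs) = c∈rs

    cols-split : cols rs ≡ below (u r) (cols rs) ++ above (u r) (cols rs)
    cols-split = sorted-split-∉ (u r) (cols-sorted rs) u∉cols

    cols-∷ : cols (r ∷ rs) ≡ below (u r) (cols rs) ++ u r ∷ above (u r) (cols rs)
    cols-∷ = ≡.trans
      (sorted-split-∈ (u r) (cols-sorted (r ∷ rs))
                      (∈-filter⁺ (columnOf? (r ∷ rs)) (∈-allFin (u r)) (here ≡.refl)))
      (≡.cong₂ (λ l l′ → l ++ u r ∷ l′)
               (cols-∷-away (_<? u r) Fin.<⇒≢) (cols-∷-away (u r <?_) (≡.≢-sym ∘ Fin.<⇒≢)))

    cols-∷-↭ : cols (r ∷ rs) ↭ u r ∷ cols rs
    cols-∷-↭ = ≡.subst₂ _↭_ (≡.sym cols-∷) (≡.cong (u r ∷_) (≡.sym cols-split)) (shift (u r) _ _)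

  count-cols : ∀ {p} {R : Pred (Fin k) p} (R? : Decidable R) rs → Unique rs →
               count R? (cols rs) ≡ count (R? ∘ u) rs
  count-cols R? []       []               = ≡.cong (count R?) cols-[]
  count-cols R? (r ∷ rs) (r∉rs ∷ unique) = ≡.trans (count-↭ R? (cols-∷-↭ r∉rs)) count-head
    where
    count-head : count R? (u r ∷ cols rs) ≡ count (R? ∘ u) (r ∷ rs)
    count-head with R? (u r)
    ... | yes _ = ≡.cong suc (count-cols R? rs unique)
    ... | no  _ = count-cols R? rs unique

  -- The comparison of r with r₀ is counted once on each side.
  count-exchange : ∀ r₀ r rs →
                   count (λ r′ → u r′ <? u r₀) (rs ∷ʳ r) +ℕ count (λ r′ → u r <? u r′) rs
                 ≡ count (λ r′ → u r <? u r′) (r₀ ∷ rs) +ℕ count (λ r′ → u r′ <? u r₀) rs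
  count-exchange r₀ r rs = begin
    count left-of-r₀ (rs ∷ʳ r) +ℕ b      ≡⟨ ≡.cong (_+ℕ b) (count-++ left-of-r₀ rs [ r ]) ⟩
    (a +ℕ count left-of-r₀ [ r ]) +ℕ b   ≡⟨ ≡.cong (λ n → (a +ℕ n) +ℕ b)
                                                   (count-singleton left-of-r₀ right-of-r (mk⇔ id id)) ⟩
    (a +ℕ count right-of-r [ r₀ ]) +ℕ b  ≡⟨ ℕ.+-assoc a _ b ⟩
    a +ℕ (count right-of-r [ r₀ ] +ℕ b)  ≡⟨ ℕ.+-comm a _ ⟩
    (count right-of-r [ r₀ ] +ℕ b) +ℕ a  ≡⟨ ≡.cong (_+ℕ a) (count-++ right-of-r [ r₀ ] rs) ⟨
    count right-of-r (r₀ ∷ rs) +ℕ a      ∎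
    where
    open ≡.≡-Reasoning
    left-of-r₀ : Decidable (λ r′ → u r′ < u r₀)
    left-of-r₀ r′ = u r′ <? u r₀
    right-of-r : Decidable (λ r′ → u r < u r′)
    right-of-r r′ = u r <? u r′
    a b : ℕ
    a = count left-of-r₀ rs
    b = count right-of-r rs

SupportedOn : ∀ {c ℓ₁ ℓ₂ : Level} (F : OrderedField c ℓ₁ ℓ₂) {k : ℕ} →
              Matrix F k → (Fin k → Fin k) → Set ℓ₁
SupportedOn F A u = ∀ r c → c ≢ u r → OrderedField._≈_ F (A r c) (OrderedField.0# F)

module Minors {c ℓ₁ ℓ₂ : Level} (F : OrderedField c ℓ₁ ℓ₂) {k : ℕ} (A : Matrix F k) (u : Fin k → Fin k)
              (u-injective : Injective _≡_ _≡_ u) (supported : SupportedOn F A u) where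

  open OrderedField F
  open OrderedFieldProperties F
  open IsTotalOrder isTotalOrder using (≲-respʳ-≈)
  open CommutativeSemigroupProperties *-commutativeSemigroup using (x∙yz≈y∙xz)
  open Laplace F A
  open Columns u u-injective
  open SetoidReasoning setoid

  pivot : Fin k → Carrier
  pivot r = A r (u r)

  minor : List (Fin k) → Carrier
  minor rs = subDet F A rs (cols rs)

  minor-[] : minor [] ≡ 1#
  minor-[] = ≡.cong (subDet F A []) cols-[]

  minor-∷ : ∀ {r rs} → Unique (r ∷ rs) →
            minor (r ∷ rs) ≈ negPow F (count (λ r′ → u r′ <? u r) rs) (pivot r * minor rs)
  minor-∷ {r} {rs} (r∉rs ∷ unique) = begin
    laplace r (cols (r ∷ rs)) (subDet F A rs)
      ≡⟨ ≡.cong (λ cs → laplace r cs (subDet F A rs)) (cols-∷ r∉rs) ⟩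
    laplace r (left ++ u r ∷ right) (subDet F A rs)
      ≈⟨ laplace-single-entry left (subDet F A rs)
           (vanishing (_<? u r) Fin.<⇒≢) (vanishing (u r <?_) (≡.≢-sym ∘ Fin.<⇒≢)) ⟩
    negPow F (length left) (pivot r * subDet F A rs (left ++ right))
      ≡⟨ ≡.cong₂ (λ n cs → negPow F n (pivot r * subDet F A rs cs))
                 (count-cols (_<? u r) rs unique) (≡.sym (cols-split r∉rs)) ⟩
    negPow F (count (λ r′ → u r′ <? u r) rs) (pivot r * minor rs)
      ∎
    where
    left right : List (Fin k)
    left  = below (u r) (cols rs)
    right = above (u r) (cols rs)
    vanishing : ∀ {p} {R : Pred (Fin k) p} (R? : Decidable R) → (∀ {c} → R c → c ≢ u r) →
                All (λ c → A r c ≈ 0#) (filter R? (cols rs))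
    vanishing R? R⇒≢ = All.map (λ Rc → supported r _ (R⇒≢ Rc)) (All.all-filter R? (cols rs))

  minor-∷ʳ : ∀ {r} rs → Unique (rs ∷ʳ r) →
             minor (rs ∷ʳ r) ≈ negPow F (count (λ r′ → u r <? u r′) rs) (pivot r * minor rs)
  minor-∷ʳ []        unique                = minor-∷ unique
  minor-∷ʳ {r} (r₀ ∷ rs) (r₀∉rs∷ʳr ∷ unique) = begin
    minor (r₀ ∷ rs ∷ʳ r)
      ≈⟨ minor-∷ (r₀∉rs∷ʳr ∷ unique) ⟩
    negPow F a′ (pivot r₀ * minor (rs ∷ʳ r))
      ≈⟨ negPow-cong a′ (*-congˡ (minor-∷ʳ rs unique)) ⟩
    negPow F a′ (pivot r₀ * negPow F b (pivot r * minor rs))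
      ≈⟨ negPow-*-negPow a′ b _ _ ⟩
    negPow F (a′ +ℕ b) (pivot r₀ * (pivot r * minor rs))
      ≡⟨ ≡.cong (λ n → negPow F n (pivot r₀ * (pivot r * minor rs))) (count-exchange r₀ r rs) ⟩
    negPow F (b′ +ℕ a) (pivot r₀ * (pivot r * minor rs))
      ≈⟨ negPow-cong (b′ +ℕ a) (x∙yz≈y∙xz (pivot r₀) (pivot r) (minor rs)) ⟩
    negPow F (b′ +ℕ a) (pivot r * (pivot r₀ * minor rs))
      ≈⟨ negPow-*-negPow b′ a _ _ ⟨
    negPow F b′ (pivot r * negPow F a (pivot r₀ * minor rs))
      ≈⟨ negPow-cong b′ (*-congˡ (minor-∷ (All.++⁻ˡ rs r₀∉rs∷ʳr ∷ Unique-++⁻ˡ rs unique))) ⟨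
    negPow F b′ (pivot r * minor (r₀ ∷ rs))
      ∎
    where
    a′ a b b′ : ℕ
    a′ = count (λ r′ → u r′ <? u r₀) (rs ∷ʳ r)
    a  = count (λ r′ → u r′ <? u r₀) rs
    b  = count (λ r′ → u r <? u r′) rs
    b′ = count (λ r′ → u r <? u r′) (r₀ ∷ rs)

  minor-≉0 : (∀ r → ¬ (pivot r ≈ 0#)) → ∀ {rs} → Unique rs → ¬ (minor rs ≈ 0#)
  minor-≉0 pivot≉0 {[]} [] rewrite minor-[] = 0≉1 ∘ sym
  minor-≉0 pivot≉0 {r ∷ rs} unique@(_ ∷ unique′) minor≈0 =
    negPow-≉0 (count (λ r′ → u r′ <? u r) rs)
              (x≉0∧y≉0⇒xy≉0 (pivot≉0 r) (minor-≉0 pivot≉0 unique′))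
              (trans (sym (minor-∷ unique)) minor≈0)

  prefix : ℕ → List (Fin k)
  prefix m = take m (allFin k)

  prefix-unique : ∀ m → Unique (prefix m)
  prefix-unique m = Unique.take⁺ m (Unique.allFin⁺ k)

  prefix-induction : ∀ {p} (P : List (Fin k) → Set p) → P [] →
                     (∀ i → P (prefix (toℕ i)) → P (prefix (suc (toℕ i)))) →
                     ∀ m → m ℕ.≤ k → P (prefix m)
  prefix-induction P base step zero    _   = base
  prefix-induction P base step (suc m) m<k = ≡.subst (P ∘ prefix ∘ suc) toℕi≡m
    (step i (≡.subst (P ∘ prefix) (≡.sym toℕi≡m) (prefix-induction P base step m (ℕ.<⇒≤ m<k))))
    where
    i : Fin k
    i = fromℕ< m<k
    toℕi≡m : toℕ i ≡ m
    toℕi≡m = Fin.toℕ-fromℕ< m<k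

  signedPivot : Fin k → Carrier
  signedPivot i = negPow F (nep u i) (pivot i)

  Δ-step : ∀ i → Δ F A u i ≈ signedPivot i * minor (prefix (toℕ i))
  Δ-step i = begin
    minor (prefix (suc (toℕ i)))
      ≡⟨ ≡.cong minor (take-suc-tabulate id i) ⟩
    minor (prefix (toℕ i) ∷ʳ i)
      ≈⟨ minor-∷ʳ (prefix (toℕ i))
                  (≡.subst Unique (take-suc-tabulate id i) (prefix-unique (suc (toℕ i)))) ⟩
    negPow F (count (λ j → u i <? u j) (prefix (toℕ i))) (pivot i * minor (prefix (toℕ i)))
      ≡⟨ ≡.cong (λ rs → negPow F (count (λ j → u i <? u j) rs) (pivot i * minor (prefix (toℕ i))))
                (≡.sym (filter-tabulate-< (_<? i) id i (λ j → mk⇔ id id))) ⟩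
    negPow F (nep u i) (pivot i * minor (prefix (toℕ i)))
      ≈⟨ negPow-distribˡ-* (nep u i) (pivot i) _ ⟩
    signedPivot i * minor (prefix (toℕ i))
      ∎

  0<minor-[] : 0# <ᶠ minor []
  0<minor-[] = ≡.subst (0# <ᶠ_) (≡.sym minor-[]) 0<1

  signedPivots-pos⇒minors-pos : (∀ i → 0# <ᶠ signedPivot i) → ∀ m → m ℕ.≤ k → 0# <ᶠ minor (prefix m)
  signedPivots-pos⇒minors-pos 0<signedPivot = prefix-induction (λ rs → 0# <ᶠ minor rs) 0<minor-[]
    λ i 0<minor → 0<-respʳ-≈ (sym (Δ-step i)) (0<x∧0<y⇒0<xy (0<signedPivot i) 0<minor)

  Δ-nonneg⇒minors-nonneg : (∀ i → 0# ≤ Δ F A u i) → ∀ m → m ℕ.≤ k → 0# ≤ minor (prefix m)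
  Δ-nonneg⇒minors-nonneg Δ≥0 =
    prefix-induction (λ rs → 0# ≤ minor rs) (proj₁ 0<minor-[]) λ i _ → Δ≥0 i

  module _ (pivot≉0 : ∀ r → ¬ (pivot r ≈ 0#)) where

    Δ-≉0 : ∀ i → ¬ (Δ F A u i ≈ 0#)
    Δ-≉0 i = minor-≉0 pivot≉0 (prefix-unique (suc (toℕ i)))

    Δ-nonneg⇒signedPivots-pos : (∀ i → 0# ≤ Δ F A u i) → ∀ i → 0# <ᶠ signedPivot i
    Δ-nonneg⇒signedPivots-pos Δ≥0 i =
      0≤xy∧0<y⇒0<x (negPow-≉0 (nep u i) (pivot≉0 i)) 0<previous (≲-respʳ-≈ (Δ-step i) (Δ≥0 i))
      where
      0<previous : 0# <ᶠ minor (prefix (toℕ i))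
      0<previous = Δ-nonneg⇒minors-nonneg Δ≥0 (toℕ i) (ℕ.<⇒≤ (Fin.toℕ<n i))
                 , minor-≉0 pivot≉0 (prefix-unique (toℕ i)) ∘ sym

    Δ-nonneg⇔signs : (∀ i → 0# ≤ Δ F A u i) ⇔ (∀ i → HasSign F (pivot i) (signPow (nep u i)))
    Δ-nonneg⇔signs = mk⇔
      (λ Δ≥0 i → Equivalence.from (sign⇔0<signedPivot i) (Δ-nonneg⇒signedPivots-pos Δ≥0 i))
      (λ signs i → proj₁ (signedPivots-pos⇒minors-pos
                            (λ j → Equivalence.to (sign⇔0<signedPivot j) (signs j)) (suc (toℕ i)) (Fin.toℕ<n i)))
      where
      sign⇔0<signedPivot : ∀ i → HasSign F (pivot i) (signPow (nep u i)) ⇔ (0# <ᶠ signedPivot i)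
      sign⇔0<signedPivot i = HasSign⇔0<negPow (nep u i) (pivot i)

module _ {c ℓ₁ ℓ₂ : Level} (F : OrderedField c ℓ₁ ℓ₂) {k : ℕ} {A : Matrix F k} {u : Fin k → Fin k} where

  open OrderedField F

  genPerm-injective : IsGenPerm F A → (∀ i → ¬ (A i (u i) ≈ 0#)) → Injective _≡_ _≡_ u
  genPerm-injective (_ , columns) Au≉0 {r} {r′} ur≡ur′ with columns (u r)
  ... | _ , _ , unique = ≡.trans (unique r (Au≉0 r)) (≡.sym (unique r′ Aur≉0))
    where
    Aur≉0 : ¬ (A r′ (u r) ≈ 0#)
    Aur≉0 = ≡.subst (λ c → ¬ (A r′ c ≈ 0#)) (≡.sym ur≡ur′) (Au≉0 r′)

  -- Equality in F need not be decidable, so the off-pattern entries are only known to vanish up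
  -- to double negation; lemma4p2 discharges it because its conclusions are stable.
  genPerm-¬¬supported : IsGenPerm F A → (∀ i → ¬ (A i (u i) ≈ 0#)) → ¬ ¬ SupportedOn F A u
  genPerm-¬¬supported (rows , _) Au≉0 = ¬¬-∀Fin λ r → ¬¬-∀Fin λ c → vanishes r c
    where
    vanishes : ∀ r c → ¬ ¬ (c ≢ u r → A r c ≈ 0#)
    vanishes r c ¬vanishes with rows r
    ... | _ , _ , unique = ¬vanishes (λ c≢ur → contradiction c≡ur c≢ur)
      where
      c≡ur : c ≡ u r
      c≡ur = ≡.trans (unique c (λ Arc≈0 → ¬vanishes (λ _ → Arc≈0))) (≡.sym (unique (u r) (Au≉0 r)))

lemma4p2 : ∀ {c ℓ₁ ℓ₂ : Level} (F : OrderedField c ℓ₁ ℓ₂) (k : _)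
    (A : Matrix F k) → IsGenPerm F A →
    (u : Fin k → Fin k) → (∀ i → ¬ (OrderedField._≈_ F (A i (u i)) (OrderedField.0# F))) →
    ((∀ i → OrderedField._≤_ F (OrderedField.0# F) (Δ F A u i))
    ⇔ (∀ i → HasSign F (A i (u i)) (signPow (nep u i))))
lemma4p2 F k A genPerm u Au≉0 = mk⇔
  (λ Δ≥0 i → HasSign-stable _ (Au≉0 i)
    (¬¬-map (λ supported → Equivalence.to (Δ-nonneg⇔signs supported) Δ≥0 i) ¬¬supported))
  (λ signs i → 0≤x-stable (Δ≉0 i)
    (¬¬-map (λ supported → Equivalence.from (Δ-nonneg⇔signs supported) signs i) ¬¬supported))
  where
  open OrderedField F
  open OrderedFieldProperties F using (HasSign-stable; 0≤x-stable)

  u-injective : Injective _≡_ _≡_ u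
  u-injective = genPerm-injective F genPerm Au≉0

  ¬¬supported : ¬ ¬ SupportedOn F A u
  ¬¬supported = genPerm-¬¬supported F genPerm Au≉0

  Δ≉0 : ∀ i → ¬ (Δ F A u i ≈ 0#)
  Δ≉0 i Δ≈0 = ¬¬supported λ supported → Minors.Δ-≉0 F A u u-injective supported Au≉0 i Δ≈0

  Δ-nonneg⇔signs : SupportedOn F A u →
                   (∀ i → 0# ≤ Δ F A u i) ⇔ (∀ i → HasSign F (A i (u i)) (signPow (nep u i)))
  Δ-nonneg⇔signs supported = Minors.Δ-nonneg⇔signs F A u u-injective supported Au≉0
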